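{- Let $\mathfrak{q}>0$ be a real number. Define polynomials $W_k(x)$, $k\ge 0$, by $W_0(x)=1$, $W_1(x)=1+\mathfrak{q}x$, and $W_k(x)=W_{k-1}(x)+xW_{k-2}(x)$ for $k\ge 2$. Then for every integer $k\ge 2$ and every real $x\neq 0$, \[\overline{G}^{\mathfrak{q},1}_{k}(x)=x^{\lfloor k/2\rfloor}\,W_{k-1}\!\left(-\tfrac{1}{x}\right).\]
   Context: For positive real numbers $\alpha,\beta$, define numbers $g_{k,j}=g^{\alpha,\beta}_{k,j}$ for integers $k\ge 0$ and $j$ by: $g_{0,0}=\alpha$, $g_{1,0}=\beta$, $g_{k,j}=0$ whenever $j<0$ or $j>\lfloor k/2\rfloor$, and $g_{k,j}=g_{k-1,j}+g_{k-2,j-1}$ for $k\ge 2$ and $0\le j\le\lfloor k/2\rfloor$. The sign-alternating Gibonacci polynomials are $\overline{G}^{\alpha,\beta}_k(x)=\sum_{j=0}^{\lfloor k/2\rfloor}(-1)^j g_{k,j}\,x^{\lfloor k/2\rfloor-j}$. Equivalently, $\overline{G}^{\alpha,\beta}_0(x)=\alpha$, $\overline{G}^{\alpha,\beta}_1(x)=\beta$, and $\overline{G}^{\alpha,\beta}_k(x)=x^{(k-1)\bmod 2}\,\overline{G}^{\alpha,\beta}_{k-1}(x)-\overline{G}^{\alpha,\beta}_{k-2}(x)$ for $k\ge 2$. Here $\overline{G}^{\mathfrak{q},1}_k$ denotes the case $\alpha=\mathfrak{q}$, $\beta=1$. -}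

module Defs where

open import Level using (Level)
open import Data.Nat using (ℕ; zero; suc; _∸_; ⌊_/2⌋)
open import Algebra.Bundles using (CommutativeRing)

module _ {c ℓ : Level} (R : CommutativeRing c ℓ) where
  open CommutativeRing R using (Carrier; _+_; _*_; -_; 0#; 1#)

  pow : Carrier → ℕ → Carrier
  pow a zero    = 1#
  pow a (suc n) = a * pow a n

  sumTo : ℕ → (ℕ → Carrier) → Carrier
  sumTo zero    f = f 0
  sumTo (suc n) f = sumTo n f + f (suc n)

  -- coefficients g^{α,β}_{k,j}; g_{k,j} = 0 for j > ⌊k/2⌋ follows from the
  -- recurrence, and the term g_{k-2,j-1} is 0 when j = 0 (j-1 < 0).
  gcoef : Carrier → Carrier → ℕ → ℕ → Carrier
  gcoef α β zero          zero    = α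
  gcoef α β zero          (suc j) = 0#
  gcoef α β (suc zero)    zero    = β
  gcoef α β (suc zero)    (suc j) = 0#
  gcoef α β (suc (suc k)) zero    = gcoef α β (suc k) zero
  gcoef α β (suc (suc k)) (suc j) = gcoef α β (suc k) (suc j) + gcoef α β k j

  Gbar : Carrier → Carrier → ℕ → Carrier → Carrier
  Gbar α β k x =
    sumTo ⌊ k /2⌋ (λ j → pow (- 1#) j * gcoef α β k j * pow x (⌊ k /2⌋ ∸ j))

  W : Carrier → ℕ → Carrier → Carrier
  W q zero          x = 1#
  W q (suc zero)    x = 1# + q * x
  W q (suc (suc k)) x = W q (suc k) x + x * W q k x

-- Substituting t = -1/x reverses Ḡ_k: x^⌊k/2⌋ · Σ_j g_{k,j} tʲ = Ḡ_k(x). The polynomials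
-- Σ_j g_{k,j} tʲ satisfy the recurrence P_{k+2} = P_{k+1} + t P_k inherited from
-- g_{k+2,j} = g_{k+1,j} + g_{k,j-1}, with P_0 = q and P_1 = 1; so do W_{k-1}, since
-- W_0 = 1 and W_1 = 1 + q t = P_1 + t P_0. Hence P_k = W_{k-1} for k ≥ 1.
module Submission where

open import Defs
open import Level using (Level)
open import Data.Nat as ℕ using (ℕ; zero; suc; _≤_; _<_; _∸_; ⌊_/2⌋; z≤n; s≤s)
import Data.Nat.Properties as ℕₚ
open import Relation.Binary.PropositionalEquality as ≡ using (_≡_)
open import Algebra.Bundles using (CommutativeRing)
import Algebra.Properties.Ring as RingProperties
import Algebra.Properties.CommutativeSemigroup as CommutativeSemigroupProperties
import Algebra.Properties.Semiring.Exp as SemiringExp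
import Algebra.Properties.CommutativeSemiring.Exp as CommutativeSemiringExp
import Relation.Binary.Reasoning.Setoid as SetoidReasoning
import Algebra.Solver.CommutativeMonoid as CommutativeMonoidSolver

module GibonacciProperties {c ℓ : Level} (R : CommutativeRing c ℓ) where
  open CommutativeRing R
  open SetoidReasoning setoid
  open RingProperties ring using (-1*x≈-x)
  open CommutativeSemigroupProperties +-commutativeSemigroup using (interchange)
  open CommutativeSemigroupProperties *-commutativeSemigroup using (x∙yz≈y∙xz)
  open SemiringExp semiring using (_^_; ^-congˡ; ^-homo-*)
  open CommutativeSemiringExp commutativeSemiring using (^-distrib-*)
  open CommutativeMonoidSolver *-commutativeMonoid using (solve; _⊜_; _⊕_)

  sumTo-cong : ∀ n {f g : ℕ → Carrier} → (∀ j → j ≤ n → f j ≈ g j) →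
               sumTo R n f ≈ sumTo R n g
  sumTo-cong zero    f≈g = f≈g 0 z≤n
  sumTo-cong (suc n) f≈g =
    +-cong (sumTo-cong n (λ j j≤n → f≈g j (ℕₚ.m≤n⇒m≤1+n j≤n))) (f≈g (suc n) ℕₚ.≤-refl)

  sumTo-+-distrib : ∀ n (f g : ℕ → Carrier) →
                    sumTo R n (λ j → f j + g j) ≈ sumTo R n f + sumTo R n g
  sumTo-+-distrib zero    f g = refl
  sumTo-+-distrib (suc n) f g =
    trans (+-congʳ (sumTo-+-distrib n f g)) (interchange _ _ _ _)

  sumTo-*-distribˡ : ∀ n a (f : ℕ → Carrier) →
                     sumTo R n (λ j → a * f j) ≈ a * sumTo R n f
  sumTo-*-distribˡ zero    a f = refl
  sumTo-*-distribˡ (suc n) a f =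
    trans (+-congʳ (sumTo-*-distribˡ n a f)) (sym (distribˡ a _ _))

  sumTo-suc-head : ∀ n (f : ℕ → Carrier) →
                   sumTo R (suc n) f ≈ f 0 + sumTo R n (λ j → f (suc j))
  sumTo-suc-head zero    f = refl
  sumTo-suc-head (suc n) f = trans (+-congʳ (sumTo-suc-head n f)) (+-assoc _ _ _)

  sumTo-head : ∀ n (f : ℕ → Carrier) → (∀ j → f (suc j) ≈ 0#) → sumTo R n f ≈ f 0
  sumTo-head zero    f tail≈0 = refl
  sumTo-head (suc n) f tail≈0 =
    trans (+-cong (sumTo-head n f tail≈0) (tail≈0 n)) (+-identityʳ _)

  pow≡^ : ∀ a n → pow R a n ≡ a ^ n
  pow≡^ a zero    = ≡.refl
  pow≡^ a (suc n) = ≡.cong (a *_) (pow≡^ a n)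

  pow-congˡ : ∀ n {a b} → a ≈ b → pow R a n ≈ pow R b n
  pow-congˡ n {a} {b} a≈b rewrite pow≡^ a n | pow≡^ b n = ^-congˡ n a≈b

  pow-homo-* : ∀ a m n → pow R a (m ℕ.+ n) ≈ pow R a m * pow R a n
  pow-homo-* a m n rewrite pow≡^ a (m ℕ.+ n) | pow≡^ a m | pow≡^ a n = ^-homo-* a m n

  pow-distrib-* : ∀ a b n → pow R (a * b) n ≈ pow R a n * pow R b n
  pow-distrib-* a b n rewrite pow≡^ (a * b) n | pow≡^ a n | pow≡^ b n = ^-distrib-* a b n

  pow-1# : ∀ n → pow R 1# n ≈ 1#
  pow-1# zero    = refl
  pow-1# (suc n) = trans (*-identityˡ _) (pow-1# n)

  pow-inverse : ∀ {x y} → x * y ≈ 1# → ∀ n → pow R x n * pow R y n ≈ 1#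
  pow-inverse {x} {y} xy≈1 n =
    trans (sym (pow-distrib-* x y n)) (trans (pow-congˡ n xy≈1) (pow-1# n))

  gcoef-vanish : ∀ α β k j → k < j ℕ.+ j → gcoef R α β k j ≈ 0#
  gcoef-vanish α β zero          (suc j) _ = refl
  gcoef-vanish α β (suc zero)    (suc j) _ = refl
  gcoef-vanish α β (suc (suc k)) (suc j) k+2<2j+2 =
    trans (+-cong (gcoef-vanish α β (suc k) (suc j) (ℕₚ.<-trans (ℕₚ.n<1+n _) k+2<2j+2))
                  (gcoef-vanish α β k j k<2j))
          (+-identityʳ 0#)
    where
    k<2j : k < j ℕ.+ j
    k<2j = ℕₚ.≤-pred (≡.subst (suc (suc k) ≤_) (ℕₚ.+-suc j j) (ℕₚ.≤-pred k+2<2j+2))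

  gcoefPoly : Carrier → Carrier → ℕ → ℕ → Carrier → Carrier
  gcoefPoly α β k n t = sumTo R n (λ j → gcoef R α β k j * pow R t j)

  gibonacci : Carrier → Carrier → Carrier → ℕ → Carrier
  gibonacci α β t zero          = α
  gibonacci α β t (suc zero)    = β
  gibonacci α β t (suc (suc k)) = gibonacci α β t (suc k) + t * gibonacci α β t k

  gcoefPoly-recurrence : ∀ α β k n t → k < suc n ℕ.+ suc n →
    gcoefPoly α β (suc (suc k)) (suc n) t ≈
    gcoefPoly α β (suc k) (suc n) t + t * gcoefPoly α β k (suc n) t
  gcoefPoly-recurrence α β k n t k<2n+2 = begin
      sumTo R (suc n) f₂
    ≈⟨ sumTo-suc-head n f₂ ⟩
      f₂ 0 + sumTo R n (λ j → f₂ (suc j))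
    ≈⟨ +-congˡ (sumTo-cong n (λ j _ → f₂-suc j)) ⟩
      f₁ 0 + sumTo R n (λ j → f₁ (suc j) + t * f₀ j)
    ≈⟨ +-congˡ (trans (sumTo-+-distrib n _ _) (+-congˡ (sumTo-*-distribˡ n t f₀))) ⟩
      f₁ 0 + (sumTo R n (λ j → f₁ (suc j)) + t * sumTo R n f₀)
    ≈⟨ sym (+-assoc _ _ _) ⟩
      (f₁ 0 + sumTo R n (λ j → f₁ (suc j))) + t * sumTo R n f₀
    ≈⟨ +-cong (sym (sumTo-suc-head n f₁)) (*-congˡ (sym top-term-vanishes)) ⟩
      sumTo R (suc n) f₁ + t * sumTo R (suc n) f₀ ∎
    where
    f₂ f₁ f₀ : ℕ → Carrier
    f₂ j = gcoef R α β (suc (suc k)) j * pow R t j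
    f₁ j = gcoef R α β (suc k) j * pow R t j
    f₀ j = gcoef R α β k j * pow R t j

    f₂-suc : ∀ j → f₂ (suc j) ≈ f₁ (suc j) + t * f₀ j
    f₂-suc j = trans (distribʳ _ _ _) (+-congˡ (x∙yz≈y∙xz (gcoef R α β k j) t (pow R t j)))

    top-term-vanishes : sumTo R n f₀ + f₀ (suc n) ≈ sumTo R n f₀
    top-term-vanishes =
      trans (+-congˡ (trans (*-congʳ (gcoef-vanish α β k (suc n) k<2n+2)) (zeroˡ _)))
            (+-identityʳ _)

  gcoefPoly≈gibonacci : ∀ α β k n t → k ≤ suc (n ℕ.+ n) →
                        gcoefPoly α β k n t ≈ gibonacci α β t k
  gcoefPoly≈gibonacci α β zero       n t _ =
    trans (sumTo-head n _ (λ _ → zeroˡ _)) (*-identityʳ α)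
  gcoefPoly≈gibonacci α β (suc zero) n t _ =
    trans (sumTo-head n _ (λ _ → zeroˡ _)) (*-identityʳ β)
  gcoefPoly≈gibonacci α β (suc (suc k)) zero t (s≤s ())
  gcoefPoly≈gibonacci α β (suc (suc k)) (suc n) t k+2≤2n+3 =
    trans (gcoefPoly-recurrence α β k n t k<2n+2)
          (+-cong (gcoefPoly≈gibonacci α β (suc k) (suc n) t (ℕₚ.m≤n⇒m≤1+n k<2n+2))
                  (*-congˡ (gcoefPoly≈gibonacci α β k (suc n) t
                             (ℕₚ.m≤n⇒m≤1+n (ℕₚ.<⇒≤ k<2n+2)))))
    where
    k<2n+2 : k < suc n ℕ.+ suc n
    k<2n+2 = ℕₚ.≤-pred k+2≤2n+3

  W≈gibonacci : ∀ q k t → W R q k t ≈ gibonacci q 1# t (suc k)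
  W≈gibonacci q zero          t = refl
  W≈gibonacci q (suc zero)    t = +-congˡ (*-comm q t)
  W≈gibonacci q (suc (suc k)) t =
    +-cong (W≈gibonacci q (suc k) t) (*-congˡ (W≈gibonacci q k t))

  ≤-suc-double-⌊/2⌋ : ∀ k → k ≤ suc (⌊ k /2⌋ ℕ.+ ⌊ k /2⌋)
  ≤-suc-double-⌊/2⌋ zero          = z≤n
  ≤-suc-double-⌊/2⌋ (suc zero)    = s≤s z≤n
  ≤-suc-double-⌊/2⌋ (suc (suc k)) =
    s≤s (s≤s (ℕₚ.≤-trans (≤-suc-double-⌊/2⌋ k) (ℕₚ.≤-reflexive (≡.sym (ℕₚ.+-suc _ _)))))

  Gbar-summand-reversal : ∀ {x y} → x * y ≈ 1# → ∀ c {m j} → j ≤ m →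
    pow R (- 1#) j * c * pow R x (m ∸ j) ≈ pow R x m * (c * pow R (- y) j)
  Gbar-summand-reversal {x} {y} xy≈1 c {m} {j} j≤m = sym (begin
      pow R x m * (c * pow R (- y) j)
    ≈⟨ *-cong (trans (reflexive (≡.cong (pow R x) (≡.sym (ℕₚ.m+[n∸m]≡n j≤m))))
                     (pow-homo-* x j (m ∸ j)))
              (*-congˡ (trans (pow-congˡ j (sym (-1*x≈-x y))) (pow-distrib-* (- 1#) y j))) ⟩
      (pow R x j * pow R x (m ∸ j)) * (c * (pow R (- 1#) j * pow R y j))
    ≈⟨ solve 5 (λ a b c e f → ((a ⊕ b) ⊕ (c ⊕ (e ⊕ f))) ⊜ (((e ⊕ c) ⊕ b) ⊕ (a ⊕ f))) refl
             (pow R x j) (pow R x (m ∸ j)) c (pow R (- 1#) j) (pow R y j) ⟩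
      (pow R (- 1#) j * c * pow R x (m ∸ j)) * (pow R x j * pow R y j)
    ≈⟨ *-congˡ (pow-inverse xy≈1 j) ⟩
      (pow R (- 1#) j * c * pow R x (m ∸ j)) * 1#
    ≈⟨ *-identityʳ _ ⟩
      pow R (- 1#) j * c * pow R x (m ∸ j) ∎)

  Gbar-reversal : ∀ {x y} → x * y ≈ 1# → ∀ α β k →
    Gbar R α β k x ≈ pow R x ⌊ k /2⌋ * gcoefPoly α β k ⌊ k /2⌋ (- y)
  Gbar-reversal xy≈1 α β k =
    trans (sumTo-cong ⌊ k /2⌋ (λ j j≤m → Gbar-summand-reversal xy≈1 (gcoef R α β k j) j≤m))
          (sumTo-*-distribˡ ⌊ k /2⌋ _ _)

proposition2p2 : {c ℓ : Level} (R : CommutativeRing c ℓ) →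
    let open CommutativeRing R in
    (q x y : Carrier) → x * y ≈ 1# →
    (k : ℕ) → 2 ≤ k →
    Gbar R q 1# k x ≈ pow R x ⌊ k /2⌋ * W R q (k ∸ 1) (- y)
proposition2p2 R q x y xy≈1 (suc k) _ = begin
    Gbar R q 1# (suc k) x
  ≈⟨ Gbar-reversal xy≈1 q 1# (suc k) ⟩
    pow R x m * gcoefPoly q 1# (suc k) m (- y)
  ≈⟨ *-congˡ (gcoefPoly≈gibonacci q 1# (suc k) m (- y) (≤-suc-double-⌊/2⌋ (suc k))) ⟩
    pow R x m * gibonacci q 1# (- y) (suc k)
  ≈⟨ *-congˡ (sym (W≈gibonacci q k (- y))) ⟩
    pow R x m * W R q k (- y) ∎
  where
  open CommutativeRing R
  open SetoidReasoning setoid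
  open GibonacciProperties R
  m = ⌊ suc k /2⌋
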